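{- Let $\lambda$ be a partition of $N$ and let $(\tau,\zeta,v,\sigma)$ be any vertex other than $\varnothing$ of the graph $G_\lambda$ defined below. Then $\sigma=\sigma_v$ and $\zeta[i]=v[i]\alpha+\mathrm{CT}_\tau[\sigma[i]]$ for all $1\le i\le N$.
   Context: $\alpha$ is an indeterminate. Partitions are drawn in French convention (rows numbered from bottom to top, columns from the left). A reverse standard tableau (RST) of shape $\lambda\vdash N$ is a bijective filling of the boxes with $1,\dots,N$ strictly decreasing along rows (left to right) and columns (bottom to top); $\mathrm{CT}_\tau[i]=c-r$ if $i$ is in column $c$, row $r$. $\tau_\lambda$ fills the columns left to right, each bottom to top, with $N,N-1,\dots,1$. $\tau^{(a,b)}$ denotes $\tau$ with entries $a,b$ interchanged. Permutations are vectors composed by $(\sigma\rho)[k]=\sigma[\rho[k]]$; for a vector $w$, $ws_i$ swaps entries $i,i+1$; $\sigma_v$ labels the positions of $v\in\mathbb{N}^N$ by $1,\dots,N$ in order of decreasing entries, ties left to right. Operations on 4-tuples $(\tau,\zeta,v,\sigma)$ ($\zeta$ a vector over $\mathbb{Z}[\alpha]$, $v\in\mathbb{N}^N$, $\sigma$ a permutation): $(\tau,\zeta,v,\sigma)s_i=(\tau,\zeta s_i,vs_i,\sigma s_i)$ if $v[i]\ne v[i+1]$; $=(\tau^{(\sigma[i],\sigma[i+1])},\zeta s_i,v,\sigma)$ if $v[i]=v[i+1]$ and $\tau^{(\sigma[i],\sigma[i+1])}$ is an RST; $=(\tau,\zeta,v,\sigma)$ otherwise. $(\tau,\zeta,v,\sigma)\Psi=(\tau,[\zeta[2],\dots,\zeta[N],\zeta[1]+\alpha],[v[2],\dots,v[N],v[1]+1],[\sigma[2],\dots,\sigma[N],\sigma[1]])$.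 The graph $G_\lambda$ has root $(\tau_\lambda,\mathrm{CT}_{\tau_\lambda},0^N,[1,\dots,N])$ and is built by adding, from each vertex $X=(\tau,\zeta,v,\sigma)$: an edge labeled $\Psi$ to $X\Psi$; an edge labeled $s_i$ to $Xs_i$ if $v[i]<v[i+1]$, or if $v[i]=v[i+1]$, $Xs_i\ne X$ and $\mathrm{CT}_\tau[\sigma[i]]-\mathrm{CT}_\tau[\sigma[i+1]]\ge 2$; and an edge labeled $s_i$ to an extra vertex $\varnothing$ if $Xs_i=X$. Vertices are the 4-tuples reachable from the root. -}

module Defs where

open import Data.Nat using (ℕ; zero; suc; _<_; _≤_; _<?_; _≟_)
open import Data.Integer as ℤ using (ℤ; +_; _-_)
open import Data.Fin as F using (Fin; toℕ; fromℕ<)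
open import Data.Fin.Properties using () renaming (_≟_ to _≟ᶠ_)
open import Data.List as L using (List; []; _∷_; concatMap; upTo; allFin; length)
open import Data.List.Relation.Unary.All using (All)
open import Data.Nat.ListAction using (sum)
open import Data.Product using (_×_; _,_; ∃-syntax; proj₁; proj₂)
open import Relation.Binary.PropositionalEquality using (_≡_)
open import Relation.Nullary using (¬_; yes; no)
open import Relation.Nullary.Decidable using (⌊_⌋)
open import Data.Bool using (Bool; true; false; if_then_else_; _∧_; _∨_)

-- A partition is a list of parts λ₁ ≥ λ₂ ≥ … > 0.
-- Rows and columns are 0-based here: the box in (1-based, French)
-- row r, column c is the pair (r-1 , c-1).  Contents c - r are
-- unaffected by this shift.

part : List ℕ → ℕ → ℕ
part []       _       = 0
part (x ∷ _)  zero    = x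
part (_ ∷ xs) (suc r) = part xs r

IsPartitionOf : ℕ → List ℕ → Set
IsPartitionOf N λs =
  All (0 <_) λs × (∀ r → part λs (suc r) ≤ part λs r) × sum λs ≡ N

Cell : Set
Cell = ℕ × ℕ   -- (row , column), 0-based

InShape : List ℕ → Cell → Set
InShape λs (r , c) = c < part λs r

-- Tableaux.  A filling with 1..N is represented by the map sending an
-- entry (Fin N, entry e ↔ number toℕ e + 1) to the box containing it.

Tableau : ℕ → Set
Tableau N = Fin N → Cell

IsRST : ∀ {N} → List ℕ → Tableau N → Set
IsRST {N} λs τ =
    (∀ e → InShape λs (τ e))
  × (∀ e f → τ e ≡ τ f → e ≡ f)
  × (∀ cell → InShape λs cell → ∃[ e ] τ e ≡ cell)
  × (∀ e f r c → τ e ≡ (r , c) → τ f ≡ (r , suc c) → toℕ f < toℕ e)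
  × (∀ e f r c → τ e ≡ (r , c) → τ f ≡ (suc r , c) → toℕ f < toℕ e)

CT : ∀ {N} → Tableau N → Fin N → ℤ
CT τ e = (+ proj₂ (τ e)) - (+ proj₁ (τ e))

transpose : ∀ {N} → Fin N → Fin N → Fin N → Fin N
transpose a b k with k ≟ᶠ a
... | yes _ = b
... | no _ with k ≟ᶠ b
...   | yes _ = a
...   | no _ = k

swapEntries : ∀ {N} → Tableau N → Fin N → Fin N → Tableau N
swapEntries τ a b e = τ (transpose a b e)

conj : List ℕ → ℕ → ℕ
conj []       c = 0
conj (x ∷ xs) c = if ⌊ c <? x ⌋ then suc (conj xs c) else conj xs c

columnReading : List ℕ → List Cell
columnReading λs = concatMap (λ c → L.map (λ r → (r , c)) (upTo (conj λs c))) (upTo (part λs 0))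

nthD : ∀ {A : Set} → A → List A → ℕ → A
nthD d []       _       = d
nthD d (x ∷ _)  zero    = x
nthD d (_ ∷ xs) (suc k) = nthD d xs k

-- τ_λ : the k-th box (0-based) of the column reading receives N - k,
-- i.e. entry e (number toℕ e + 1) lies in box number N - 1 - toℕ e.
tauλ : (N : ℕ) → List ℕ → Tableau N
tauλ N λs e = nthD (0 , 0) (columnReading λs) (N Data.Nat.∸ suc (toℕ e))

-- Elements of ℤ[α] occurring here: a·α + b stored as (a , b).
Lin : Set
Lin = ℤ × ℤ

addα : Lin → Lin
addα (a , b) = (a ℤ.+ + 1 , b)

record Tuple (N : ℕ) : Set where
  constructor ⟨_,_,_,_⟩
  field
    τ : Tableau N
    ζ : Fin N → Lin
    v : Fin N → ℕ
    σ : Fin N → Fin N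
open Tuple public

_≈T_ : ∀ {N} → Tuple N → Tuple N → Set
X ≈T Y = (∀ e → τ X e ≡ τ Y e) × (∀ k → ζ X k ≡ ζ Y k)
       × (∀ k → v X k ≡ v Y k) × (∀ k → σ X k ≡ σ Y k)

_·s[_,_] : ∀ {N} {A : Set} → (Fin N → A) → Fin N → Fin N → (Fin N → A)
(w ·s[ i , j ]) k = w (transpose i j k)

next : ∀ {N} → Fin N → Fin N
next {suc n} k with suc (toℕ k) <? suc n
... | yes p = fromℕ< p
... | no _  = F.zero

isLast : ∀ {N} → Fin N → Bool
isLast {N} k = ⌊ suc (toℕ k) ≟ N ⌋

Ψ : ∀ {N} → Tuple N → Tuple N
Ψ X = ⟨ τ X
      , (λ k → if isLast k then addα (ζ X (next k)) else ζ X (next k))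
      , (λ k → if isLast k then suc (v X (next k)) else v X (next k))
      , (λ k → σ X (next k)) ⟩

sMove : ∀ {N} → Tuple N → Fin N → Fin N → Tuple N
sMove X i j = ⟨ τ X , ζ X ·s[ i , j ] , v X ·s[ i , j ] , σ X ·s[ i , j ] ⟩

sSwap : ∀ {N} → Tuple N → Fin N → Fin N → Tuple N
sSwap X i j = ⟨ swapEntries (τ X) (σ X i) (σ X j) , ζ X ·s[ i , j ] , v X , σ X ⟩

root : (N : ℕ) → List ℕ → Tuple N
root N λs = ⟨ tauλ N λs , (λ k → (+ 0 , CT (tauλ N λs) k)) , (λ _ → 0) , (λ k → k) ⟩

-- vertices of G_λ other than ∅ : tuples reachable from the root
-- (edges into ∅ never lead further, so they are omitted)
data Vertex (N : ℕ) (λs : List ℕ) : Tuple N → Set where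
  root-v : Vertex N λs (root N λs)
  ψ-edge : ∀ {X} → Vertex N λs X → Vertex N λs (Ψ X)
  s-lt   : ∀ {X} (i j : Fin N) → toℕ j ≡ suc (toℕ i) →
           v X i < v X j → Vertex N λs X → Vertex N λs (sMove X i j)
  s-eq   : ∀ {X} (i j : Fin N) → toℕ j ≡ suc (toℕ i) →
           v X i ≡ v X j →
           IsRST λs (swapEntries (τ X) (σ X i) (σ X j)) →
           ¬ (sSwap X i j ≈T X) →
           ℤ.+ 2 ℤ.≤ CT (τ X) (σ X i) - CT (τ X) (σ X j) →
           Vertex N λs X → Vertex N λs (sSwap X i j)

-- σ_v as 0-based labels: label of position k is
-- #{ j : v[j] > v[k] } + #{ j < k : v[j] = v[k] }
before : ∀ {N} → (Fin N → ℕ) → Fin N → Fin N → Bool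
before v k j = ⌊ v k <? v j ⌋ ∨ (⌊ v k ≟ v j ⌋ ∧ ⌊ toℕ j <? toℕ k ⌋)

sigmaV : ∀ {N} → (Fin N → ℕ) → Fin N → ℕ
sigmaV {N} v k = length (L.filterᵇ (before v k) (allFin N))

module Submission where

-- The proof is an induction over the edges of G_λ with the invariant
-- "σ = σ_v, ζ has the stated form, and σ is injective" (injectivity is needed
-- to transport contents through the tableau swap τ ↦ τ^{(σ[i],σ[i+1])}).
--
-- The only non-trivial part is the identity σ = σ_v.  The label σ_v[k] is the
-- rank of position k for the strict order "m precedes k" (larger entry, or
-- equal entry further left), i.e. the number of positions preceding k.  A rank
-- is invariant under any relabelling π of positions that transports the order
-- (lemma sigmaV-relabel), because counting is invariant under permutations.
-- The edges Ψ and s_i (with v[i] < v[i+1]) are such relabellings: Ψ is the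
-- cyclic shift, which raises the numerical key  v[k]·N + (N - 1 - k)  of every
-- position by exactly one; an adjacent transposition preserves the relative
-- order of all pairs of positions except {i, i+1}, whose entries differ.
-- The remaining edge s_i (v[i] = v[i+1]) changes neither v nor σ.

open import Defs
open import Data.Nat
  using (ℕ; zero; suc; _+_; _*_; _∸_; _<_; _≤_; _<?_; _≟_; s≤s)
open import Data.Nat.Properties
  using ( +-0-commutativeMonoid; <-irrefl; <-trans; ≤-pred; <⇒≤; n<1+n; ≤∧≢⇒<
        ; <-cmp; <-asym; <⇒≢; +-comm; +-suc; +-identityʳ; m≤m+n; +-monoʳ-<; +-cancelˡ-<; *-monoˡ-≤
        ; ∸-monoʳ-<; ∸-cancelʳ-<; +-∸-assoc; n∸n≡0; m∸n≤m; suc-injective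
        ; module ≤-Reasoning )
open import Data.Integer using (+_)
open import Data.Fin using (Fin; toℕ; fromℕ; fromℕ<; inject₁)
open import Data.Fin.Properties
  using (toℕ-injective; toℕ<n; toℕ-fromℕ; toℕ-fromℕ<; toℕ-inject₁)
  renaming (_≟_ to _≟ᶠ_)
open import Data.Fin.Permutation
  using (Permutation; permutation; _⟨$⟩ʳ_; _⟨$⟩ˡ_; inverseˡ)
open import Data.Bool using (Bool; true; false; if_then_else_)
open import Data.List using (List; tabulate; filterᵇ; length)
open import Data.Product using (_×_; _,_)
open import Data.Sum using (_⊎_; inj₁; inj₂)
open import Data.Empty using (⊥-elim)
open import Function using (_∘_; _⇔_; mk⇔; Equivalence)
open import Function.Definitions using (Injective)
open import Relation.Nullary using (Dec; yes; no; does; ¬_)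
open import Relation.Nullary.Decidable using (_⊎-dec_; _×-dec_; isYes≗does; does-⇔)
open import Relation.Binary.PropositionalEquality
open import Relation.Binary.Definitions using (tri<; tri≈; tri>)
open import Algebra.Properties.CommutativeMonoid.Sum +-0-commutativeMonoid
  using (sum; sum-permute; sum-cong-≗; sum-replicate-zero)

module _ {N : ℕ} (i j : Fin N) where

  transpose-left : transpose i j i ≡ j
  transpose-left with i ≟ᶠ i
  ... | yes _   = refl
  ... | no i≢i  = ⊥-elim (i≢i refl)

  transpose-right : transpose i j j ≡ i
  transpose-right with j ≟ᶠ i
  ... | yes refl = refl
  ... | no _ with j ≟ᶠ j
  ...   | yes _  = refl
  ...   | no j≢j = ⊥-elim (j≢j refl)

  transpose-other : ∀ {k} → k ≢ i → k ≢ j → transpose i j k ≡ k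
  transpose-other {k} k≢i k≢j with k ≟ᶠ i
  ... | yes k≡i = ⊥-elim (k≢i k≡i)
  ... | no _ with k ≟ᶠ j
  ...   | yes k≡j = ⊥-elim (k≢j k≡j)
  ...   | no _    = refl

  data Position (k : Fin N) : Set where
    at-i   : k ≡ i → Position k
    at-j   : k ≢ i → k ≡ j → Position k
    beside : k ≢ i → k ≢ j → Position k

  position : ∀ k → Position k
  position k with k ≟ᶠ i | k ≟ᶠ j
  ... | yes k≡i | _       = at-i k≡i
  ... | no k≢i  | yes k≡j = at-j k≢i k≡j
  ... | no k≢i  | no k≢j  = beside k≢i k≢j

  transpose-involutive : ∀ k → transpose i j (transpose i j k) ≡ k
  transpose-involutive k with position k
  ... | at-i refl     rewrite transpose-left  = transpose-right
  ... | at-j _ refl   rewrite transpose-right = transpose-left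
  ... | beside k≢i k≢j rewrite transpose-other k≢i k≢j = transpose-other k≢i k≢j

  transposition : Permutation N N
  transposition = permutation (transpose i j) (transpose i j)
                              transpose-involutive transpose-involutive

  transpose-invariant : ∀ {A : Set} (w : Fin N → A) → w i ≡ w j →
                        ∀ k → w (transpose i j k) ≡ w k
  transpose-invariant w wi≡wj k with position k
  ... | at-i refl      rewrite transpose-left  = sym wi≡wj
  ... | at-j _ refl    rewrite transpose-right = wi≡wj
  ... | beside k≢i k≢j rewrite transpose-other k≢i k≢j = refl

  transpose-preserves-< : toℕ j ≡ suc (toℕ i) → ∀ {k m} → ¬ (k ≡ j × m ≡ i) →
                          toℕ m < toℕ k → toℕ (transpose i j m) < toℕ (transpose i j k)
  transpose-preserves-< j≡i+1 {k} {m} notSwapped m<k = byCases (position k) (position m)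
    where
    i<j : toℕ i < toℕ j
    i<j = subst (toℕ i <_) (sym j≡i+1) (n<1+n (toℕ i))

    m≢ : ∀ {x} → toℕ m < toℕ x → m ≢ x
    m≢ m<x refl = <-irrefl refl m<x

    byCases : Position k → Position m → toℕ (transpose i j m) < toℕ (transpose i j k)
    byCases (at-i refl) _
      rewrite transpose-left | transpose-other (m≢ m<k) (m≢ (<-trans m<k i<j)) =
        <-trans m<k i<j
    byCases (at-j _ refl) (at-i m≡i) = ⊥-elim (notSwapped (refl , m≡i))
    byCases (at-j _ refl) (at-j _ refl) = ⊥-elim (<-irrefl refl m<k)
    byCases (at-j _ refl) (beside m≢i _)
      rewrite transpose-right | transpose-other m≢i (m≢ m<k) =
        ≤∧≢⇒< (≤-pred (subst (toℕ m <_) j≡i+1 m<k)) (m≢i ∘ toℕ-injective)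
    byCases (beside k≢i k≢j) (at-i refl)
      rewrite transpose-other k≢i k≢j | transpose-left =
        ≤∧≢⇒< (subst (_≤ toℕ k) (sym j≡i+1) m<k) (k≢j ∘ sym ∘ toℕ-injective)
    byCases (beside k≢i k≢j) (at-j _ refl)
      rewrite transpose-other k≢i k≢j | transpose-right = <-trans i<j m<k
    byCases (beside k≢i k≢j) (beside m≢i m≢j)
      rewrite transpose-other k≢i k≢j | transpose-other m≢i m≢j = m<k

-- Conjugation: σ ∘ (i j) = (σ[i] σ[j]) ∘ σ for injective σ.  This is how
-- the swap of positions in ζ becomes the swap of entries in τ.
transpose-conjugate : ∀ {N M} (i j : Fin N) (σ′ : Fin N → Fin M) → Injective _≡_ _≡_ σ′ →
                      ∀ k → σ′ (transpose i j k) ≡ transpose (σ′ i) (σ′ j) (σ′ k)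
transpose-conjugate i j σ′ inj k with position i j k
... | at-i refl rewrite transpose-left k j | transpose-left (σ′ k) (σ′ j) = refl
... | at-j _ refl rewrite transpose-right i k | transpose-right (σ′ i) (σ′ k) = refl
... | beside k≢i k≢j rewrite transpose-other i j k≢i k≢j
                           | transpose-other (σ′ i) (σ′ j) (k≢i ∘ inj) (k≢j ∘ inj) = refl

isLast-true : ∀ {N} {k : Fin N} → isLast k ≡ true → suc (toℕ k) ≡ N
isLast-true {N} {k} _ with suc (toℕ k) ≟ N
isLast-true {N} {k} _  | yes k+1≡N = k+1≡N
isLast-true {N} {k} () | no _

isLast-false : ∀ {N} {k : Fin N} → isLast k ≡ false → suc (toℕ k) ≢ N
isLast-false {N} {k} _ with suc (toℕ k) ≟ N
isLast-false {N} {k} () | yes _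
isLast-false {N} {k} _  | no k+1≢N = k+1≢N

next-interior : ∀ {N} (k : Fin N) → suc (toℕ k) < N → toℕ (next k) ≡ suc (toℕ k)
next-interior {suc n} k k+1<N with suc (toℕ k) <? suc n
... | yes k+1<N′ = toℕ-fromℕ< k+1<N′
... | no k+1≮N   = ⊥-elim (k+1≮N k+1<N)

next-wrap : ∀ {N} (k : Fin N) → suc (toℕ k) ≡ N → toℕ (next k) ≡ 0
next-wrap {suc n} k k+1≡N with suc (toℕ k) <? suc n
... | yes k+1<N = ⊥-elim (<-irrefl k+1≡N k+1<N)
... | no _      = refl

data ShiftCase {N : ℕ} (k : Fin N) : Set where
  interior : isLast k ≡ false → suc (toℕ k) < N → toℕ (next k) ≡ suc (toℕ k) → ShiftCase k
  wrap     : isLast k ≡ true  → suc (toℕ k) ≡ N → toℕ (next k) ≡ 0 → ShiftCase k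

shiftCase : ∀ {N} (k : Fin N) → ShiftCase k
shiftCase k with isLast k in lastEq
... | true  = wrap lastEq (isLast-true lastEq) (next-wrap k (isLast-true lastEq))
... | false = interior lastEq k+1<N (next-interior k k+1<N)
  where k+1<N = ≤∧≢⇒< (toℕ<n k) (isLast-false lastEq)

prev : ∀ {N} → Fin N → Fin N
prev {suc n} Fin.zero    = fromℕ n
prev {suc n} (Fin.suc k) = inject₁ k

next-prev : ∀ {N} (y : Fin N) → next (prev y) ≡ y
next-prev {suc n} Fin.zero =
  toℕ-injective (next-wrap (fromℕ n) (cong suc (toℕ-fromℕ n)))
next-prev {suc n} (Fin.suc k) =
  toℕ-injective (trans (next-interior (inject₁ k) k+1<N) (cong suc (toℕ-inject₁ k)))
  where k+1<N = subst (λ t → suc t < suc n) (sym (toℕ-inject₁ k)) (s≤s (toℕ<n k))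

toℕ-prev-suc : ∀ {n m} (y : Fin (suc n)) → toℕ y ≡ suc m → toℕ (prev y) ≡ m
toℕ-prev-suc (Fin.suc y) y≡m+1 = trans (toℕ-inject₁ y) (suc-injective y≡m+1)

prev-next : ∀ {N} (x : Fin N) → prev (next x) ≡ x
prev-next {suc n} x with shiftCase x
... | wrap _ x+1≡N next≡0 =
  trans (cong prev (toℕ-injective {j = Fin.zero} next≡0))
        (toℕ-injective (trans (toℕ-fromℕ n) (suc-injective (sym x+1≡N))))
... | interior _ _ next≡x+1 = toℕ-injective (toℕ-prev-suc (next x) next≡x+1)

cyclicShift : ∀ {N} → Permutation N N
cyclicShift = permutation next prev next-prev prev-next

count : ∀ {n} → (Fin n → Bool) → ℕ
count p = sum (λ m → if p m then 1 else 0)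

length-filter-tabulate : ∀ {n} {A : Set} (p : A → Bool) (f : Fin n → A) →
                         length (filterᵇ p (tabulate f)) ≡ count (p ∘ f)
length-filter-tabulate {zero}  p f = refl
length-filter-tabulate {suc n} p f with p (f Fin.zero)
... | true  = cong suc (length-filter-tabulate p (f ∘ Fin.suc))
... | false = length-filter-tabulate p (f ∘ Fin.suc)

count-cong : ∀ {n} {p q : Fin n → Bool} → (∀ m → p m ≡ q m) → count p ≡ count q
count-cong p≗q = sum-cong-≗ (λ m → cong (λ b → if b then 1 else 0) (p≗q m))

count-permute : ∀ {n} (p : Fin n → Bool) (π : Permutation n n) →
                count p ≡ count (p ∘ (π ⟨$⟩ʳ_))
count-permute p π = sum-permute (λ m → if p m then 1 else 0) π

count-below : ∀ {n} x → x ≤ n → count {n} (λ m → does (toℕ m <? x)) ≡ x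
count-below {n}     zero    _         = sum-replicate-zero n
count-below {suc n} (suc x) (s≤s x≤n) = cong suc (count-below x x≤n)

-- The labelling σ_v as a rank function

Precedes : ∀ {N} → (Fin N → ℕ) → Fin N → Fin N → Set
Precedes w m k = w k < w m ⊎ (w k ≡ w m × toℕ m < toℕ k)

precedes? : ∀ {N} (w : Fin N → ℕ) m k → Dec (Precedes w m k)
precedes? w m k = (w k <? w m) ⊎-dec ((w k ≟ w m) ×-dec (toℕ m <? toℕ k))

sigmaV-count : ∀ {N} (w : Fin N → ℕ) k →
               sigmaV w k ≡ count (λ m → does (precedes? w m k))
sigmaV-count w k = trans (length-filter-tabulate (before w k) (λ m → m))
                         (count-cong before≡precedes?)
  where
  before≡precedes? : ∀ m → before w k m ≡ does (precedes? w m k)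
  before≡precedes? m rewrite isYes≗does (w k <? w m) | isYes≗does (w k ≟ w m)
                           | isYes≗does (toℕ m <? toℕ k) = refl

sigmaV-relabel : ∀ {N} (w w′ : Fin N → ℕ) (π : Permutation N N) →
                 (∀ m k → Precedes w′ m k ⇔ Precedes w (π ⟨$⟩ʳ m) (π ⟨$⟩ʳ k)) →
                 ∀ k → sigmaV w′ k ≡ sigmaV w (π ⟨$⟩ʳ k)
sigmaV-relabel {N} w w′ π transport k = begin
  sigmaV w′ k
    ≡⟨ sigmaV-count w′ k ⟩
  count {N} (λ m → does (precedes? w′ m k))
    ≡⟨ count-cong (λ m → does-⇔ (transport m k) (precedes? w′ m k) (precedes? w _ _)) ⟩
  count {N} (λ m → does (precedes? w (π ⟨$⟩ʳ m) (π ⟨$⟩ʳ k)))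
    ≡⟨ count-permute _ π ⟨
  count {N} (λ m → does (precedes? w m (π ⟨$⟩ʳ k)))
    ≡⟨ sigmaV-count w (π ⟨$⟩ʳ k) ⟨
  sigmaV w (π ⟨$⟩ʳ k)
    ∎
  where open ≡-Reasoning

-- For a constant vector the order is the order of positions, so σ_w is the
-- identity.
sigmaV-constant : ∀ {N} c (k : Fin N) → sigmaV (λ _ → c) k ≡ toℕ k
sigmaV-constant {N} c k = begin
  sigmaV (λ _ → c) k
    ≡⟨ sigmaV-count (λ _ → c) k ⟩
  count {N} (λ m → does (precedes? (λ _ → c) m k))
    ≡⟨ count-cong (λ m → does-⇔ positional (precedes? _ m k) (toℕ m <? toℕ k)) ⟩
  count {N} (λ m → does (toℕ m <? toℕ k))
    ≡⟨ count-below (toℕ k) (<⇒≤ (toℕ<n k)) ⟩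
  toℕ k
    ∎
  where
  open ≡-Reasoning
  positional : ∀ {m} → Precedes (λ _ → c) m k ⇔ toℕ m < toℕ k
  positional = mk⇔ (λ { (inj₁ c<c) → ⊥-elim (<-irrefl refl c<c) ; (inj₂ (_ , m<k)) → m<k })
                   (λ m<k → inj₂ (refl , m<k))

-- Ψ relabels positions along the cyclic shift

-- A numerical key realising the order: m precedes k iff key k < key m.
key : ∀ {N} → (Fin N → ℕ) → Fin N → ℕ
key {N} w k = w k * N + (N ∸ suc (toℕ k))

-- Mixed-radix comparison: the leading digit decides.
radix-< : ∀ {N a b x} y → a < b → x < N → a * N + x < b * N + y
radix-< {N} {a} {b} {x} y a<b x<N = begin-strict
  a * N + x   <⟨ +-monoʳ-< (a * N) x<N ⟩
  a * N + N   ≡⟨ +-comm (a * N) N ⟩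
  suc a * N   ≤⟨ *-monoˡ-≤ N a<b ⟩
  b * N       ≤⟨ m≤m+n (b * N) y ⟩
  b * N + y   ∎
  where open ≤-Reasoning

digit<N : ∀ {N} (k : Fin N) → N ∸ suc (toℕ k) < N
digit<N {suc n} k = s≤s (m∸n≤m n (toℕ k))

precedes⇔key : ∀ {N} (w : Fin N → ℕ) m k → Precedes w m k ⇔ key w k < key w m
precedes⇔key {N} w m k = mk⇔ toKey fromKey
  where
  digit-< : toℕ m < toℕ k → N ∸ suc (toℕ k) < N ∸ suc (toℕ m)
  digit-< m<k = ∸-monoʳ-< (s≤s m<k) (toℕ<n k)

  toKey : Precedes w m k → key w k < key w m
  toKey (inj₁ wk<wm)         = radix-< _ wk<wm (digit<N k)
  toKey (inj₂ (wk≡wm , m<k)) rewrite wk≡wm = +-monoʳ-< (w m * N) (digit-< m<k)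

  fromKey : key w k < key w m → Precedes w m k
  fromKey key< with <-cmp (w k) (w m)
  ... | tri< wk<wm _ _ = inj₁ wk<wm
  ... | tri≈ _ wk≡wm _ rewrite wk≡wm =
        inj₂ (refl , ≤-pred (∸-cancelʳ-< {o = N} (+-cancelˡ-< (w m * N) _ _ key<)))
  ... | tri> _ _ wm<wk = ⊥-elim (<-asym key< (radix-< _ wm<wk (digit<N m)))

shiftValues : ∀ {N} → (Fin N → ℕ) → Fin N → ℕ
shiftValues w k = if isLast k then suc (w (next k)) else w (next k)

key-shift : ∀ {N} (w : Fin N → ℕ) k → key (shiftValues w) k ≡ suc (key w (next k))
key-shift {N} w k with shiftCase k
... | interior notLast k+1<N next≡k+1 rewrite notLast | next≡k+1 = begin
  w (next k) * N + (N ∸ suc (toℕ k))             ≡⟨ cong (λ t → w (next k) * N + t) (+-∸-assoc 1 k+1<N) ⟩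
  w (next k) * N + suc (N ∸ suc (suc (toℕ k)))   ≡⟨ +-suc (w (next k) * N) _ ⟩
  suc (w (next k) * N + (N ∸ suc (suc (toℕ k)))) ∎
  where open ≡-Reasoning
... | wrap last k+1≡N next≡0 rewrite last | next≡0 = begin
  suc a * N + (N ∸ suc (toℕ k))   ≡⟨ cong (λ t → suc a * N + (N ∸ t)) k+1≡N ⟩
  suc a * N + (N ∸ N)             ≡⟨ cong (λ t → suc a * N + t) (n∸n≡0 N) ⟩
  suc a * N + 0                   ≡⟨ +-identityʳ (suc a * N) ⟩
  N + a * N                       ≡⟨ +-comm N (a * N) ⟩
  a * N + N                       ≡⟨ cong (λ t → a * N + t) (sym k+1≡N) ⟩
  a * N + suc (toℕ k)             ≡⟨ +-suc (a * N) (toℕ k) ⟩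
  suc (a * N + toℕ k)             ≡⟨ cong (λ t → suc (a * N + (t ∸ 1))) k+1≡N ⟩
  suc (a * N + (N ∸ 1))           ∎
  where
  open ≡-Reasoning
  a = w (next k)

precedes-shift : ∀ {N} (w : Fin N → ℕ) m k →
                 Precedes (shiftValues w) m k ⇔ Precedes w (next m) (next k)
precedes-shift w m k = mk⇔
  (λ prec → Equivalence.from (precedes⇔key w _ _)
              (≤-pred (subst₂ _<_ (key-shift w k) (key-shift w m)
                        (Equivalence.to (precedes⇔key (shiftValues w) m k) prec))))
  (λ prec → Equivalence.from (precedes⇔key (shiftValues w) m k)
              (subst₂ _<_ (sym (key-shift w k)) (sym (key-shift w m))
                 (s≤s (Equivalence.to (precedes⇔key w _ _) prec))))

-- s_i with v[i] ≠ v[i+1] relabels positions along the transposition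

-- Equal entries are never at the swapped pair, so their relative position is
-- preserved by the adjacent transposition.
precedes-move : ∀ {N} (w : Fin N → ℕ) (i j : Fin N) → toℕ j ≡ suc (toℕ i) → w i ≢ w j →
                ∀ m k → Precedes (w ∘ transpose i j) m k ⇔
                        Precedes w (transpose i j m) (transpose i j k)
precedes-move w i j j≡i+1 wi≢wj m k = mk⇔ forward backward
  where
  T = transpose i j

  forward : Precedes (w ∘ T) m k → Precedes w (T m) (T k)
  forward (inj₁ lt)         = inj₁ lt
  forward (inj₂ (eq , m<k)) = inj₂ (eq , transpose-preserves-< i j j≡i+1 swapped m<k)
    where
    swapped : ¬ (k ≡ j × m ≡ i)
    swapped (refl , refl) =
      wi≢wj (trans (sym (cong w (transpose-right i j))) (trans eq (cong w (transpose-left i j))))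

  backward : Precedes w (T m) (T k) → Precedes (w ∘ T) m k
  backward (inj₁ lt)           = inj₁ lt
  backward (inj₂ (eq , Tm<Tk)) =
    inj₂ (eq , subst₂ (λ x y → toℕ x < toℕ y)
                      (transpose-involutive i j m) (transpose-involutive i j k)
                      (transpose-preserves-< i j j≡i+1 swapped Tm<Tk))
    where
    swapped : ¬ (T k ≡ j × T m ≡ i)
    swapped (Tk≡j , Tm≡i) = wi≢wj (trans (sym (cong w Tm≡i)) (trans (sym eq) (cong w Tk≡j)))

-- σ = σ_v, the formula for ζ, and injectivity of σ (needed to transport
-- contents through the entry swap of the edge s_i with v[i] = v[i+1]).
record Invariant {N : ℕ} (X : Tuple N) : Set where
  field
    σ-is-σv     : ∀ k → toℕ (σ X k) ≡ sigmaV (v X) k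
    ζ-formula   : ∀ k → ζ X k ≡ (+ (v X k) , CT (τ X) (σ X k))
    σ-injective : Injective _≡_ _≡_ (σ X)
open Invariant

injective-∘-permutation : ∀ {N} {A : Set} {f : Fin N → A} (π : Permutation N N) →
                          Injective _≡_ _≡_ f → Injective _≡_ _≡_ (f ∘ (π ⟨$⟩ʳ_))
injective-∘-permutation π f-inj eq =
  trans (sym (inverseˡ π)) (trans (cong (π ⟨$⟩ˡ_) (f-inj eq)) (inverseˡ π))

-- At the root v = 0, so σ_v is the identity, and ζ = CT_{τ_λ} by definition.
invariant-root : ∀ N λs → Invariant (root N λs)
invariant-root N λs = record
  { σ-is-σv     = λ k → sym (sigmaV-constant 0 k)
  ; ζ-formula   = λ k → refl
  ; σ-injective = λ eq → eq
  }

addα-suc : ∀ (b : Bool) a c → (if b then addα (+ a , c) else (+ a , c))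
                            ≡ (+ (if b then suc a else a) , c)
addα-suc true  a c = cong (λ n → (+ n , c)) (+-comm a 1)
addα-suc false a c = refl

invariant-Ψ : ∀ {N} (X : Tuple N) → Invariant X → Invariant (Ψ X)
invariant-Ψ X inv = record
  { σ-is-σv     = λ k → trans (σ-is-σv inv (next k))
                              (sym (sigmaV-relabel (v X) (v (Ψ X)) cyclicShift
                                                   (precedes-shift (v X)) k))
  ; ζ-formula   = λ k → trans (cong (λ z → if isLast k then addα z else z)
                                    (ζ-formula inv (next k)))
                              (addα-suc (isLast k) _ _)
  ; σ-injective = injective-∘-permutation cyclicShift (σ-injective inv)
  }

invariant-move : ∀ {N} (X : Tuple N) (i j : Fin N) → toℕ j ≡ suc (toℕ i) → v X i ≢ v X j →
                 Invariant X → Invariant (sMove X i j)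
invariant-move X i j j≡i+1 vi≢vj inv = record
  { σ-is-σv     = λ k → trans (σ-is-σv inv (transpose i j k))
                              (sym (sigmaV-relabel (v X) (v X ·s[ i , j ]) (transposition i j)
                                                   (precedes-move (v X) i j j≡i+1 vi≢vj) k))
  ; ζ-formula   = λ k → ζ-formula inv (transpose i j k)
  ; σ-injective = injective-∘-permutation (transposition i j) (σ-injective inv)
  }

-- s_i with v[i] = v[i+1] keeps v and σ; swapping ζ at i, i+1 matches swapping
-- the entries σ[i], σ[i+1] of τ.
invariant-swap : ∀ {N} (X : Tuple N) (i j : Fin N) → v X i ≡ v X j →
                 Invariant X → Invariant (sSwap X i j)
invariant-swap X i j vi≡vj inv = record
  { σ-is-σv     = σ-is-σv inv
  ; ζ-formula   = λ k → trans (ζ-formula inv (transpose i j k))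
                              (cong₂ (λ a e → (+ a , CT (τ X) e))
                                     (transpose-invariant i j (v X) vi≡vj k)
                                     (transpose-conjugate i j (σ X) (σ-injective inv) k))
  ; σ-injective = σ-injective inv
  }

invariant : ∀ {N λs} {X : Tuple N} → Vertex N λs X → Invariant X
invariant {N} {λs} root-v                 = invariant-root N λs
invariant (ψ-edge {X} edge)               = invariant-Ψ X (invariant edge)
invariant (s-lt {X} i j j≡i+1 vi<vj edge) =
  invariant-move X i j j≡i+1 (<⇒≢ vi<vj) (invariant edge)
invariant (s-eq {X} i j _ vi≡vj _ _ _ edge) = invariant-swap X i j vi≡vj (invariant edge)

proposition2p15 : (N : ℕ) (λs : List ℕ) → IsPartitionOf N λs →
    (X : Tuple N) → Vertex N λs X →
    (∀ k → toℕ (σ X k) ≡ sigmaV (v X) k)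
    × (∀ k → ζ X k ≡ (+ (v X k) , CT (τ X) (σ X k)))
proposition2p15 N λs _ X vertex = σ-is-σv inv , ζ-formula inv
  where inv = invariant vertex
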